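{- If $G$ is a connected graph of order $n(G)$ and minimum degree $\delta(G)$ whose complement $\overline{G}$ is also connected, then $$\chi_\mu(G)+\chi_\mu(\overline{G})\le\left\lceil\frac{n(G)-\mu(G)+2}{2}\right\rceil+\left\lceil\frac{\delta(G)+3}{2}\right\rceil.$$
   Context: For a connected graph $G$ and $S\subseteq V(G)$, two vertices $x,y\in S$ are $S$-visible if there is a shortest $x,y$-path $P$ in $G$ with $V(P)\cap S=\{x,y\}$. $S$ is a mutual-visibility set if any two vertices of $S$ are $S$-visible. The mutual-visibility number $\mu(G)$ is the largest cardinality of a mutual-visibility set. A mutual-visibility coloring of $G$ is a partition of $V(G)$ into mutual-visibility sets, and the mutual-visibility chromatic number $\chi_\mu(G)$ is the smallest number of classes in such a partition. -}

module Defs where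

open import Data.Nat using (ℕ; zero; suc; _+_; _≤_)
open import Data.Bool using (Bool; true; false; not; _∧_)
open import Data.Fin using (Fin; _≟_)
open import Data.Fin.Subset using (Subset; _∈_; _∉_; ∣_∣)
open import Data.Vec using (tabulate)
open import Data.List using (List; []; _∷_)
open import Data.List.Membership.Propositional using () renaming (_∈_ to _∈ₗ_)
open import Data.Product using (Σ; ∃; _×_; _,_)
open import Data.Sum using (_⊎_)
open import Relation.Nullary using (¬_)
open import Relation.Nullary.Decidable using (⌊_⌋)
open import Relation.Binary.PropositionalEquality using (_≡_; refl; sym; cong₂)

record Graph (n : ℕ) : Set where
  field
    adj    : Fin n → Fin n → Bool
    symm   : ∀ x y → adj x y ≡ adj y x
    irrefl : ∀ x → adj x x ≡ false
open Graph public

complement : ∀ {n} → Graph n → Graph n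
complement {n} G = record
  { adj = λ x y → not (adj G x y) ∧ not ⌊ x ≟ y ⌋
  ; symm = λ x y → cong₂ (λ a b → not a ∧ not b) (symm G x y) (eqsym x y)
  ; irrefl = λ x → lemma x
  }
  where
  eqsym : ∀ (x y : Fin n) → ⌊ x ≟ y ⌋ ≡ ⌊ y ≟ x ⌋
  eqsym x y with x ≟ y | y ≟ x
  ... | Relation.Nullary.yes _ | Relation.Nullary.yes _ = refl
  ... | Relation.Nullary.no _  | Relation.Nullary.no _  = refl
  ... | Relation.Nullary.yes p | Relation.Nullary.no q  = Data.Empty.⊥-elim (q (sym p))
    where import Data.Empty
  ... | Relation.Nullary.no p  | Relation.Nullary.yes q = Data.Empty.⊥-elim (p (sym q))
    where import Data.Empty
  lemma : ∀ (x : Fin n) → not (adj G x x) ∧ not ⌊ x ≟ x ⌋ ≡ false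
  lemma x with x ≟ x
  ... | Relation.Nullary.yes _ = Data.Bool.Properties.∧-zeroʳ (not (adj G x x))
    where import Data.Bool.Properties
  ... | Relation.Nullary.no ¬p = Data.Empty.⊥-elim (¬p refl)
    where import Data.Empty

module _ {n : ℕ} (G : Graph n) where

  data Walk : Fin n → Fin n → Set where
    here : ∀ {x} → Walk x x
    step : ∀ {x} y {z} → adj G x y ≡ true → Walk y z → Walk x z

  length : ∀ {x y} → Walk x y → ℕ
  length here           = zero
  length (step _ _ w)   = suc (length w)

  vertices : ∀ {x y} → Walk x y → List (Fin n)
  vertices {x} here          = x ∷ []
  vertices {x} (step _ _ w)  = x ∷ vertices w

  Connected : Set
  Connected = ∀ x y → Walk x y

  IsShortest : ∀ {x y} → Walk x y → Set
  IsShortest {x} {y} P = ∀ (Q : Walk x y) → length P ≤ length Q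

  Visible : Subset n → Fin n → Fin n → Set
  Visible S x y = Σ (Walk x y) λ P → IsShortest P ×
    (∀ v → v ∈ₗ vertices P → v ∈ S → v ≡ x ⊎ v ≡ y)

  IsMutualVisibilitySet : Subset n → Set
  IsMutualVisibilitySet S = ∀ x y → x ∈ S → y ∈ S → Visible S x y

  IsMu : ℕ → Set
  IsMu m = (Σ (Subset n) λ S → IsMutualVisibilitySet S × ∣ S ∣ ≡ m)
         × (∀ S → IsMutualVisibilitySet S → ∣ S ∣ ≤ m)

  colourClass : ∀ {k} → (Fin n → Fin k) → Fin k → Subset n
  colourClass c i = tabulate (λ v → ⌊ c v ≟ i ⌋)

  IsMVColouring : ∀ {k} → (Fin n → Fin k) → Set
  IsMVColouring c = ∀ i → IsMutualVisibilitySet (colourClass c i)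

  IsChiMu : ℕ → Set
  IsChiMu k = (Σ (Fin n → Fin k) IsMVColouring)
            × (∀ j → (c : Fin n → Fin j) → IsMVColouring c → k ≤ j)

  degree : Fin n → ℕ
  degree v = ∣ tabulate (adj G v) ∣

  IsMinDegree : ℕ → Set
  IsMinDegree d = (∃ λ v → degree v ≡ d) × (∀ v → d ≤ degree v)

-- Give a mutual-visibility set S one colour and pair up the remaining
-- vertices: in a connected graph any set of at most two vertices is a
-- mutual-visibility set, so χμ ≤ 1 + ⌈|V ∖ S| / 2⌉. For G take S of size μ(G).
-- For the complement take the neighbourhood of v in Ḡ, where v has minimum
-- degree in G: two of its vertices are adjacent in Ḡ or joined through v, so
-- it is a mutual-visibility set of Ḡ, and its complement N_G[v] has δ + 1
-- vertices.
module Submission where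

open import Defs
open import Data.Nat using (ℕ; zero; suc; _+_; _*_; _∸_; _≤_; _/_; z≤n; s≤s)
open import Data.Nat.Properties
  using (≤-trans; ≤-reflexive; m≤n⇒m≤1+n; +-suc; +-assoc; +-comm; *-suc; +-monoˡ-≤; +-mono-≤; +-monoʳ-≤; n≤1+n; *-comm; suc-injective; module ≤-Reasoning)
open import Data.Nat.DivMod using (m*n/n≡m; /-monoˡ-≤)
open import Data.Bool using (Bool; true; false)
open import Data.Bool.Properties using () renaming (_≟_ to _≟ᵇ_)
open import Data.Fin using (Fin; zero; suc; _≟_; punchIn)
open import Data.Fin.Properties using (any?; punchIn-injective; punchInᵢ≢i)
open import Data.Fin.Subset using (Subset; inside; outside; _∈_; _⊆_; ∁; _∪_; ⁅_⁆; ∣_∣)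
open import Data.Fin.Subset.Properties
  using (x∈∁p⇒x∉p; x∈p∪q⁺; x∈⁅x⁆; p⊆q⇒∣p∣≤∣q∣; ∣⁅x⁆∣≡1; ∣∁p∣≡n∸∣p∣)
open import Data.Vec using ([]; _∷_; tabulate; here; there)
open import Data.Vec.Properties using ([]=⇒lookup; lookup⇒[]=; lookup∘tabulate)
open import Data.List.Relation.Unary.Any using () renaming (here to hereₗ; there to thereₗ)
open import Data.Product as Prod using (Σ; _×_; _,_; proj₁)
open import Data.Sum as Sum using (_⊎_; inj₁; inj₂)
open import Function using (_∘_; id)
open import Relation.Nullary using (¬_; Dec; yes; no; contradiction)
open import Relation.Nullary.Decidable using (_×-dec_)
open import Relation.Unary using (Pred; Decidable)
open import Relation.Binary.PropositionalEquality
open import Level using (Level)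

private
  variable
    ℓ : Level
    n : ℕ

least : ∀ {P : Pred ℕ ℓ} → Decidable P → ∀ L → P L → Σ ℕ λ k → P k × (∀ j → P j → k ≤ j)
least P? L pL with P? 0
... | yes p0 = 0 , p0 , λ _ _ → z≤n
least P? zero pL | no ¬p0 = contradiction pL ¬p0
least P? (suc L) pL | no ¬p0 with least (P? ∘ suc) L pL
... | k , pk , minimal = suc k , pk , λ { zero p0 → contradiction p0 ¬p0 ; (suc j) pj → s≤s (minimal j pj) }

∣p∪q∣≤∣p∣+∣q∣ : (p q : Subset n) → ∣ p ∪ q ∣ ≤ ∣ p ∣ + ∣ q ∣
∣p∪q∣≤∣p∣+∣q∣ []            []            = z≤n
∣p∪q∣≤∣p∣+∣q∣ (outside ∷ p) (outside ∷ q) = ∣p∪q∣≤∣p∣+∣q∣ p q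
∣p∪q∣≤∣p∣+∣q∣ (outside ∷ p) (inside  ∷ q) = ≤-trans (s≤s (∣p∪q∣≤∣p∣+∣q∣ p q)) (≤-reflexive (sym (+-suc ∣ p ∣ ∣ q ∣)))
∣p∪q∣≤∣p∣+∣q∣ (inside  ∷ p) (outside ∷ q) = s≤s (∣p∪q∣≤∣p∣+∣q∣ p q)
∣p∪q∣≤∣p∣+∣q∣ (inside  ∷ p) (inside  ∷ q) = s≤s (≤-trans (∣p∪q∣≤∣p∣+∣q∣ p q) (+-monoʳ-≤ ∣ p ∣ (n≤1+n ∣ q ∣)))

∈-tabulate⁻ : ∀ {f : Fin n → Bool} {v} → v ∈ tabulate f → f v ≡ true
∈-tabulate⁻ {f = f} {v} v∈ = trans (sym (lookup∘tabulate f v)) ([]=⇒lookup v∈)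

∈-tabulate⁺ : ∀ {f : Fin n → Bool} {v} → f v ≡ true → v ∈ tabulate f
∈-tabulate⁺ {f = f} {v} fv = lookup⇒[]= v (tabulate f) (trans (lookup∘tabulate f v) fv)

2*m≤n⇒m≤n/2 : ∀ {m n} → 2 * m ≤ n → m ≤ n / 2
2*m≤n⇒m≤n/2 {m} {n} le = subst (_≤ n / 2) (m*n/n≡m m 2) (/-monoˡ-≤ 2 (subst (_≤ n) (*-comm 2 m) le))

AtMostOne : Pred (Fin n) ℓ → Set ℓ
AtMostOne P = ∀ {x y} → P x → P y → x ≡ y

AtMostTwo : Pred (Fin n) ℓ → Set ℓ
AtMostTwo P = ∀ {x y z} → P x → P y → P z → x ≡ y ⊎ z ≡ x ⊎ z ≡ y

module _ {P : Pred (Fin (suc n)) ℓ} where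

  onlyZero⇒atMostOne : (∀ {v} → ¬ P (suc v)) → AtMostOne P
  onlyZero⇒atMostOne ∉P {zero}  {zero}  _  _  = refl
  onlyZero⇒atMostOne ∉P {zero}  {suc y} _  py = contradiction py ∉P
  onlyZero⇒atMostOne ∉P {suc x} {_}     px _  = contradiction px ∉P

  atMostOne-suc : ¬ P zero → AtMostOne (P ∘ suc) → AtMostOne P
  atMostOne-suc ∉P one {zero}  {_}     px _  = contradiction px ∉P
  atMostOne-suc ∉P one {suc x} {zero}  _  py = contradiction py ∉P
  atMostOne-suc ∉P one {suc x} {suc y} px py = cong suc (one px py)

  atMostOne⇒atMostTwo : AtMostOne P → AtMostTwo P
  atMostOne⇒atMostTwo one px py _ = inj₁ (one px py)

  atMostTwo-suc : ¬ P zero → AtMostTwo (P ∘ suc) → AtMostTwo P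
  atMostTwo-suc ∉P two {zero}                  px _  _  = contradiction px ∉P
  atMostTwo-suc ∉P two {suc _} {zero}          _  py _  = contradiction py ∉P
  atMostTwo-suc ∉P two {suc _} {suc _} {zero}  _  _  pz = contradiction pz ∉P
  atMostTwo-suc ∉P two {suc _} {suc _} {suc _} px py pz =
    Sum.map (cong suc) (Sum.map (cong suc) (cong suc)) (two px py pz)

  atMostOne-suc⇒atMostTwo : AtMostOne (P ∘ suc) → AtMostTwo P
  atMostOne-suc⇒atMostTwo one {zero}  {zero}  {_}     _  _  _  = inj₁ refl
  atMostOne-suc⇒atMostTwo one {zero}  {suc _} {zero}  _  _  _  = inj₂ (inj₁ refl)
  atMostOne-suc⇒atMostTwo one {zero}  {suc _} {suc _} _  py pz = inj₂ (inj₂ (cong suc (one pz py)))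
  atMostOne-suc⇒atMostTwo one {suc _} {zero}  {zero}  _  _  _  = inj₂ (inj₂ refl)
  atMostOne-suc⇒atMostTwo one {suc _} {zero}  {suc _} px _  pz = inj₂ (inj₁ (cong suc (one pz px)))
  atMostOne-suc⇒atMostTwo one {suc _} {suc _} {_}     px py _  = inj₁ (cong suc (one px py))

record PairColouring (S : Subset n) : Set where
  field
    k            : ℕ
    colour       : Fin n → Fin (suc k)
    zero-class⊆S : ∀ {v} → colour v ≡ zero → v ∈ S
    classes≤2    : ∀ {i} → i ≢ zero → AtMostTwo (λ v → colour v ≡ i)
    -- Either the vertices outside S fill k classes, or one class is a
    -- singleton still open for a partner.
    balanced     : 2 * k ≤ ∣ ∁ S ∣
                 ⊎ 2 * k ≤ suc ∣ ∁ S ∣ × Σ (Fin (suc k)) λ j → j ≢ zero × AtMostOne (λ v → colour v ≡ j)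

  bound : 2 * k ≤ suc ∣ ∁ S ∣
  bound = Sum.[ m≤n⇒m≤1+n , proj₁ ]′ balanced

module _ {S : Subset n} (C : PairColouring S) where
  open PairColouring C

  extend-inside : PairColouring (inside ∷ S)
  extend-inside = record
    { k            = k
    ; colour       = colour′
    ; zero-class⊆S = λ { {zero} _ → here ; {suc _} e → there (zero-class⊆S e) }
    ; classes≤2    = λ i≢0 → atMostTwo-suc (i≢0 ∘ sym) (classes≤2 i≢0)
    ; balanced     = Sum.map₂ (Prod.map₂ (Prod.map₂ λ (j≢0 , one) → j≢0 , atMostOne-suc (j≢0 ∘ sym) one)) balanced
    }
    where
    colour′ : Fin (suc n) → Fin (suc k)
    colour′ zero    = zero
    colour′ (suc v) = colour v

  open-new-class : 2 * k ≤ ∣ ∁ S ∣ → PairColouring (outside ∷ S)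
  open-new-class even = record
    { k            = suc k
    ; colour       = colour′
    ; zero-class⊆S = λ { {suc v} e → there (zero-class⊆S (punchIn-injective (suc zero) (colour v) zero e)) }
    ; classes≤2    = classes≤2′
    ; balanced     = inj₂ (subst (_≤ 2 + ∣ ∁ S ∣) (sym (*-suc 2 k)) (s≤s (s≤s even)) , suc zero , (λ ()) , new-class)
    }
    where
    -- the new vertex gets colour 1; punchIn 1 shifts the old colours 1, 2, … up by one
    colour′ : Fin (suc n) → Fin (suc (suc k))
    colour′ zero    = suc zero
    colour′ (suc v) = punchIn (suc zero) (colour v)

    new-class : AtMostOne (λ v → colour′ v ≡ suc zero)
    new-class = onlyZero⇒atMostOne (λ {v} → punchInᵢ≢i (suc zero) (colour v))

    classes≤2′ : ∀ {i} → i ≢ zero → AtMostTwo (λ v → colour′ v ≡ i)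
    classes≤2′ {zero}        i≢0 = contradiction refl i≢0
    classes≤2′ {suc zero}    _   = atMostOne⇒atMostTwo new-class
    classes≤2′ {suc (suc j)} _   = atMostTwo-suc (λ ()) λ px py pz →
      classes≤2 (λ ()) (punchIn-injective (suc zero) _ (suc j) px)
                       (punchIn-injective (suc zero) _ (suc j) py)
                       (punchIn-injective (suc zero) _ (suc j) pz)

  fill-open-class : (j : Fin (suc k)) → j ≢ zero → AtMostOne (λ v → colour v ≡ j) →
                    2 * k ≤ suc ∣ ∁ S ∣ → PairColouring (outside ∷ S)
  fill-open-class j j≢0 open-class odd = record
    { k            = k
    ; colour       = colour′
    ; zero-class⊆S = λ { {zero} e → contradiction e j≢0 ; {suc _} e → there (zero-class⊆S e) }
    ; classes≤2    = classes≤2′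
    ; balanced     = inj₁ odd
    }
    where
    colour′ : Fin (suc n) → Fin (suc k)
    colour′ zero    = j
    colour′ (suc v) = colour v

    classes≤2′ : ∀ {i} → i ≢ zero → AtMostTwo (λ v → colour′ v ≡ i)
    classes≤2′ {i} i≢0 with j ≟ i
    ... | yes refl = atMostOne-suc⇒atMostTwo open-class
    ... | no j≢i   = atMostTwo-suc j≢i (classes≤2 i≢0)

  extend-outside : PairColouring (outside ∷ S)
  extend-outside with balanced
  ... | inj₁ even                         = open-new-class even
  ... | inj₂ (odd , j , j≢0 , open-class) = fill-open-class j j≢0 open-class odd

pairColouring : (S : Subset n) → PairColouring S
pairColouring []            = record
  { k = 0 ; colour = λ () ; zero-class⊆S = λ { {()} } ; classes≤2 = λ { _ {()} } ; balanced = inj₁ z≤n }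
pairColouring (inside  ∷ S) = extend-inside  (pairColouring S)
pairColouring (outside ∷ S) = extend-outside (pairColouring S)

module _ (H : Graph n) where

  walkOfLength? : ∀ l x y → Dec (Σ (Walk H x y) λ w → length H w ≡ l)
  walkOfLength? zero x y with x ≟ y
  ... | yes refl = yes (here , refl)
  ... | no x≢y   = no λ { (here , _) → x≢y refl ; (step _ _ _ , ()) }
  walkOfLength? (suc l) x y with any? (λ z → (adj H x z ≟ᵇ true) ×-dec walkOfLength? l z y)
  ... | yes (z , xz , w , |w|≡l) = yes (step z xz w , cong suc |w|≡l)
  ... | no ∄w = no λ { (here , ()) ; (step z xz w , |w|≡l) → ∄w (z , xz , w , suc-injective |w|≡l) }

  shortestWalk : Connected H → ∀ x y → Σ (Walk H x y) (IsShortest H)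
  shortestWalk conn x y with least (λ l → walkOfLength? l x y) (length H (conn x y)) (conn x y , refl)
  ... | _ , (w , refl) , minimal = w , λ Q → minimal (length H Q) (Q , refl)

  visible-self : ∀ S x → Visible H S x x
  visible-self S x = here , (λ _ → z≤n) , λ { _ (hereₗ v≡x) _ → inj₁ v≡x }

  mvSet-⊆ : ∀ {S′ S} → S′ ⊆ S → IsMutualVisibilitySet H S → IsMutualVisibilitySet H S′
  mvSet-⊆ S′⊆S mv x y x∈S′ y∈S′ =
    Prod.map₂ (Prod.map₂ λ onlyEnds v v∈P v∈S′ → onlyEnds v v∈P (S′⊆S v∈S′)) (mv x y (S′⊆S x∈S′) (S′⊆S y∈S′))

  atMostTwo⇒mvSet : ∀ {S} → Connected H → AtMostTwo (_∈ S) → IsMutualVisibilitySet H S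
  atMostTwo⇒mvSet {S} conn two x y x∈S y∈S with x ≟ y
  ... | yes refl = visible-self S x
  ... | no x≢y   = let P , shortest = shortestWalk conn x y in
    P , shortest , λ v _ v∈S → Sum.[ (λ x≡y → contradiction x≡y x≢y) , id ]′ (two x∈S y∈S v∈S)

  neighbourhood-mvSet : ∀ v → IsMutualVisibilitySet H (tabulate (adj H v))
  neighbourhood-mvSet v x y x∈N y∈N with x ≟ y | adj H x y in xy
  ... | yes refl | _    = visible-self _ x
  ... | no x≢y   | true = step y xy here , edge-shortest , λ
    { _ (hereₗ u≡x) _ → inj₁ u≡x ; _ (thereₗ (hereₗ u≡y)) _ → inj₂ u≡y }
    where
    edge-shortest : IsShortest H (step y xy here)
    edge-shortest here         = contradiction refl x≢y
    edge-shortest (step _ _ _) = s≤s z≤n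
  ... | no x≢y   | false = path , path-shortest , λ
    { _ (hereₗ u≡x) _ → inj₁ u≡x
    ; _ (thereₗ (hereₗ refl)) v∈N → contradiction (trans (sym (∈-tabulate⁻ v∈N)) (irrefl H v)) λ ()
    ; _ (thereₗ (thereₗ (hereₗ u≡y))) _ → inj₂ u≡y }
    where
    path : Walk H x y
    path = step v (trans (symm H x v) (∈-tabulate⁻ x∈N)) (step y (∈-tabulate⁻ y∈N) here)

    path-shortest : IsShortest H path
    path-shortest here                    = contradiction refl x≢y
    path-shortest (step _ xy′ here)       = contradiction (trans (sym xy′) xy) λ ()
    path-shortest (step _ _ (step _ _ _)) = s≤s (s≤s z≤n)

  ∈-colourClass⁻ : ∀ {k} {c : Fin n → Fin k} {i v} → v ∈ colourClass H c i → c v ≡ i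
  ∈-colourClass⁻ {c = c} {i} {v} v∈ with c v ≟ i | ∈-tabulate⁻ v∈
  ... | yes cv≡i | _ = cv≡i

  pairColouring-isMVColouring : ∀ {S} → Connected H → IsMutualVisibilitySet H S →
                                (C : PairColouring S) → IsMVColouring H (PairColouring.colour C)
  pairColouring-isMVColouring conn mvS C zero    = mvSet-⊆ (zero-class⊆S ∘ ∈-colourClass⁻) mvS
    where open PairColouring C
  pairColouring-isMVColouring conn mvS C (suc i) = atMostTwo⇒mvSet conn λ x∈ y∈ z∈ →
    classes≤2 (λ ()) (∈-colourClass⁻ x∈) (∈-colourClass⁻ y∈) (∈-colourClass⁻ z∈)
    where open PairColouring C

  χμ≤[∣∁S∣+3]/2 : ∀ {S a} → Connected H → IsMutualVisibilitySet H S → IsChiMu H a → a ≤ (∣ ∁ S ∣ + 3) / 2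
  χμ≤[∣∁S∣+3]/2 {S} conn mvS (_ , minimal) =
    ≤-trans (minimal (suc k) colour (pairColouring-isMVColouring conn mvS C))
            (2*m≤n⇒m≤n/2 (subst₂ _≤_ (sym (*-suc 2 k)) (+-comm 3 ∣ ∁ S ∣) (+-monoʳ-≤ 2 bound)))
    where
    C = pairColouring S
    open PairColouring C

module _ (G : Graph n) (v : Fin n) where

  adj-complement : ∀ {u} → adj G v u ≡ false → v ≢ u → adj (complement G) v u ≡ true
  adj-complement {u} vu v≢u with v ≟ u
  ... | yes v≡u = contradiction v≡u v≢u
  ... | no _    rewrite vu = refl

  ∁N̄⊆N∪⁅v⁆ : ∁ (tabulate (adj (complement G) v)) ⊆ tabulate (adj G v) ∪ ⁅ v ⁆
  ∁N̄⊆N∪⁅v⁆ {u} u∈∁N̄ with adj G v u in vu | v ≟ u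
  ... | true  | _        = x∈p∪q⁺ (inj₁ (∈-tabulate⁺ vu))
  ... | false | yes refl = x∈p∪q⁺ (inj₂ (x∈⁅x⁆ v))
  ... | false | no v≢u   = contradiction (∈-tabulate⁺ (adj-complement vu v≢u)) (x∈∁p⇒x∉p u∈∁N̄)

  ∣∁N̄∣≤degree+1 : ∣ ∁ (tabulate (adj (complement G) v)) ∣ ≤ degree G v + 1
  ∣∁N̄∣≤degree+1 = begin
    ∣ ∁ (tabulate (adj (complement G) v)) ∣ ≤⟨ p⊆q⇒∣p∣≤∣q∣ ∁N̄⊆N∪⁅v⁆ ⟩
    ∣ tabulate (adj G v) ∪ ⁅ v ⁆ ∣           ≤⟨ ∣p∪q∣≤∣p∣+∣q∣ (tabulate (adj G v)) ⁅ v ⁆ ⟩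
    degree G v + ∣ ⁅ v ⁆ ∣                  ≡⟨ cong (degree G v +_) (∣⁅x⁆∣≡1 v) ⟩
    degree G v + 1                          ∎
    where open ≤-Reasoning

proposition5p9 : ∀ (n : ℕ) (G : Graph n) → 1 ≤ n →
    Connected G → Connected (complement G) →
    ∀ (m d a b : ℕ) → IsMu G m → IsMinDegree G d →
    IsChiMu G a → IsChiMu (complement G) b →
    a + b ≤ ((n ∸ m + 2) + 1) / 2 + ((d + 3) + 1) / 2
proposition5p9 n G _ connG connḠ m d a b ((S , mvS , ∣S∣≡m) , _) ((v , deg≡d) , _) χG χḠ =
  +-mono-≤ boundG boundḠ
  where
  boundG : a ≤ ((n ∸ m + 2) + 1) / 2
  boundG = begin
    a                         ≤⟨ χμ≤[∣∁S∣+3]/2 G connG mvS χG ⟩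
    (∣ ∁ S ∣ + 3) / 2         ≡⟨ cong (λ s → (s + 3) / 2) (trans (∣∁p∣≡n∸∣p∣ S) (cong (n ∸_) ∣S∣≡m)) ⟩
    (n ∸ m + 3) / 2           ≡⟨ cong (_/ 2) (sym (+-assoc (n ∸ m) 2 1)) ⟩
    ((n ∸ m + 2) + 1) / 2     ∎
    where open ≤-Reasoning

  boundḠ : b ≤ ((d + 3) + 1) / 2
  boundḠ = begin
    b                                              ≤⟨ χμ≤[∣∁S∣+3]/2 (complement G) connḠ (neighbourhood-mvSet (complement G) v) χḠ ⟩
    (∣ ∁ (tabulate (adj (complement G) v)) ∣ + 3) / 2 ≤⟨ /-monoˡ-≤ 2 (+-monoˡ-≤ 3 (∣∁N̄∣≤degree+1 G v)) ⟩
    (degree G v + 1 + 3) / 2                       ≡⟨ cong (_/ 2) (trans (+-assoc (degree G v) 1 3) (cong (_+ 4) deg≡d)) ⟩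
    (d + 4) / 2                                    ≡⟨ cong (_/ 2) (sym (+-assoc d 3 1)) ⟩
    ((d + 3) + 1) / 2                              ∎
    where open ≤-Reasoning
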